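{- Let $\mathbf r=(r_1,r_2,r_3)\in\mathcal R$ and write $U_{\mathbf r}(t)=\prod_{\nu=1}^3(a_\nu t+b_\nu)$ with $a_\nu=r_\nu\sigma_3$ and $b_\nu=r_\nu\ell+1$. Then for $t\in\mathbb Z$: (i) If $\mathbf r=(1,2,3)$, then $U_{\mathbf r}(0)=1$, $\ell=0$ and $b_\nu=1$ for $\nu=1,2,3$ (and these properties are equivalent). Moreover in this case $U_{\mathbf r}(t)\equiv1\pmod{2\sigma_3^2}$ for all $t\in\mathbb Z$, and $U_{\mathbf r}(t)\equiv1\pmod{\sigma_3^3}$ whenever $t\not\equiv-1\pmod 3$. In particular $U_{\mathbf r}(t)$ is odd and $U_{\mathbf r}(t)\equiv1\pmod 8$. (ii) If $\mathbf r\ne(1,2,3)$, then $\ell\ne0$, $b_\nu\ne1$ ($\nu=1,2,3$), and $U_{\mathbf r}(0)\equiv1\pmod{\sigma_3\ell}$, $U_{\mathbf r}(1)\equiv1\pmod{\sigma_3(\sigma_3+\ell)}$, $U_{\mathbf r}(t)\equiv1\pmod{\sigma_3\gcd(\sigma_3,\ell)}$ for all $t\in\mathbb Z$. In particular, if $\sigma_3$ is even, then $U_{\mathbf r}(t)$ is odd and $U_{\mathbf r}(t)\equiv1\pmod4$. If $\sigma_3$ is odd, then $U_{\mathbf r}(t)\equiv\delta(t)\pmod2$ and $U_{\mathbf r}(t)\equiv1\pmod{2^{\delta(t)}\sigma_3\gcd(\sigma_3,\ell)}$, where $\delta(t)=1$ if $t\equiv\ell\pmod2$ and $\delta(t)=0$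 otherwise.
   Context: $\mathcal R$ is the set of triples $\mathbf r=(r_1,r_2,r_3)$ of pairwise coprime positive integers with $r_1<r_2<r_3$. For $\mathbf r\in\mathcal R$ put $\sigma_1=r_1+r_2+r_3$, $\sigma_2=r_1r_2+r_1r_3+r_2r_3$, $\sigma_3=r_1r_2r_3$, and let $\ell$ be the unique integer with $0\le\ell<\sigma_3$ and $\ell\sigma_2\equiv-\sigma_1\pmod{\sigma_3}$ ($\sigma_2$ is invertible modulo $\sigma_3$). Define $U_{\mathbf r}(t)=\prod_{\nu=1}^3\bigl(r_\nu(\sigma_3t+\ell)+1\bigr)$. -}

module Defs where

open import Data.Nat as ℕ using (ℕ)
open import Data.Integer as ℤ using (ℤ; +_; _+_; _*_; _-_; ∣_∣)
import Data.Nat.Divisibility as ND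
open import Data.Bool using (if_then_else_)
open import Relation.Nullary.Decidable using (⌊_⌋)

σ₁ : ℕ → ℕ → ℕ → ℕ
σ₁ r₁ r₂ r₃ = r₁ ℕ.+ r₂ ℕ.+ r₃

σ₂ : ℕ → ℕ → ℕ → ℕ
σ₂ r₁ r₂ r₃ = r₁ ℕ.* r₂ ℕ.+ r₁ ℕ.* r₃ ℕ.+ r₂ ℕ.* r₃

σ₃ : ℕ → ℕ → ℕ → ℕ
σ₃ r₁ r₂ r₃ = r₁ ℕ.* r₂ ℕ.* r₃

open import Data.Nat.Coprimality using (Coprime)
open import Data.Product using (_×_)

Inℛ : ℕ → ℕ → ℕ → Set
Inℛ r₁ r₂ r₃ = (0 ℕ.< r₁) × (r₁ ℕ.< r₂) × (r₂ ℕ.< r₃)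
             × Coprime r₁ r₂ × Coprime r₁ r₃ × Coprime r₂ r₃

-- ℓ is the number of the paper: 0 ≤ ℓ < σ₃ and ℓ σ₂ ≡ -σ₁ (mod σ₃),
-- i.e. σ₃ ∣ ℓ σ₂ + σ₁ (in ℕ)
Isℓ : ℕ → ℕ → ℕ → ℕ → Set
Isℓ r₁ r₂ r₃ ℓ = (ℓ ℕ.< σ₃ r₁ r₂ r₃)
               × (σ₃ r₁ r₂ r₃ ND.∣ ℓ ℕ.* σ₂ r₁ r₂ r₃ ℕ.+ σ₁ r₁ r₂ r₃)

a : ℕ → ℕ → ℕ → ℕ → ℤ
a r₁ r₂ r₃ rν = + (rν ℕ.* σ₃ r₁ r₂ r₃)

b : ℕ → ℕ → ℤ
b ℓ rν = + (rν ℕ.* ℓ ℕ.+ 1)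

U : ℕ → ℕ → ℕ → ℕ → ℤ → ℤ
U r₁ r₂ r₃ ℓ t = (a r₁ r₂ r₃ r₁ * t + b ℓ r₁)
               * (a r₁ r₂ r₃ r₂ * t + b ℓ r₂)
               * (a r₁ r₂ r₃ r₃ * t + b ℓ r₃)

δ : ℕ → ℤ → ℕ
δ ℓ t = if ⌊ 2 ND.∣? ∣ t - + ℓ ∣ ⌋ then 1 else 0

-- With x = σ₃ t + ℓ one has U(t) = ∏ (r_ν x + 1), so
--   U(t) − 1 = x (σ₁ + σ₂ x + σ₃ x²) = σ₃ x (k + σ₂ t + x²),
-- because σ₁ + σ₂ ℓ = k σ₃ by the choice of ℓ.  Hence σ₃ d ∣ U(t) − 1 for every
-- divisor d of x; taking d = ℓ, σ₃ + ℓ and gcd(σ₃, ℓ) gives the congruences of (ii).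
-- The parity statements follow by tracking the parity of x and of the factors
-- r_ν x + 1.  When ℓ = 0, σ₃ ∣ σ₁ forces r = (1, 2, 3), and then
-- U(t) − 1 = 36 t (1 + 11 t + 36 t²), whose cofactor is even and, unless
-- t ≡ −1 (mod 3), divisible by 3.
module Submission where

open import Defs
open import Data.Nat as ℕ using (ℕ; zero; suc; s≤s; z≤n; _<_; _≤_)
open import Data.Nat.GCD using (gcd; gcd[m,n]∣m; gcd[m,n]∣n; gcd-greatest)
import Data.Nat.Divisibility as ND
import Data.Nat.Properties as ℕP
open import Data.Nat.Coprimality using (Coprime; coprime-divisor)
open import Data.Nat.LCM using (lcm-least)
open import Data.Integer as ℤ using (ℤ; +_; _-_; _*_; _+_)
import Data.Integer.Properties as ℤP
import Data.Integer.DivMod as ℤD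
open import Data.Integer.Divisibility using (_∣_)
import Data.Integer.Divisibility.Signed as S
open S using (divides) renaming (_∣_ to _∣ₛ_)
open import Data.Integer.Tactic.RingSolver using (solve-∀)
open import Data.Product using (_×_; _,_; proj₂)
open import Data.Sum using (_⊎_; inj₁; inj₂)
open import Data.Bool using (if_then_else_)
open import Function.Base using (_∘_)
open import Function.Bundles using (_⇔_; mk⇔; Equivalence)
open import Function.Properties.Equivalence using () renaming (sym to ⇔-sym; trans to ⇔-trans)
open import Relation.Binary.PropositionalEquality
open import Relation.Nullary using (¬_; Dec; yes; no; contradiction)
open import Relation.Nullary.Decidable using (⌊_⌋; from-no)

open Equivalence using (to; from)

∣⇒+∣+ : ∀ {m n} → m ND.∣ n → + m ∣ₛ + n
∣⇒+∣+ = S.∣ᵤ⇒∣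

∤⇒+∤+ : ∀ {m n} → ¬ m ND.∣ n → ¬ + m ∣ₛ + n
∤⇒+∤+ m∤n = m∤n ∘ S.∣⇒∣ᵤ

*-pres-∣ₛ : ∀ {i j m n} → i ∣ₛ m → j ∣ₛ n → i * j ∣ₛ m * n
*-pres-∣ₛ {j = j} {m = m} i∣m j∣n = S.∣-trans (S.*-monoˡ-∣ j i∣m) (S.*-monoʳ-∣ m j∣n)

n∣i-[i%n] : ∀ i n .{{_ : ℤ.NonZero n}} → n ∣ₛ i - + (i ℤD.% n)
n∣i-[i%n] i n = divides (i ℤD./ n)
  (trans (cong (_- + (i ℤD.% n)) (ℤD.a≡a%n+[a/n]*n i n)) ([r+x]-r≡x (+ (i ℤD.% n)) _))
  where
  [r+x]-r≡x : ∀ r x → r + x - r ≡ x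
  [r+x]-r≡x = solve-∀

2∣i⊎2∣i+1 : ∀ i → + 2 ∣ₛ i ⊎ + 2 ∣ₛ i + + 1
2∣i⊎2∣i+1 i with i ℤD.% + 2 | ℤD.n%d<d i (+ 2) | n∣i-[i%n] i (+ 2)
... | 0 | _ | 2∣i-0 = inj₁ (subst (+ 2 ∣ₛ_) (ℤP.+-identityʳ i) 2∣i-0)
... | 1 | _ | 2∣i-1 = inj₂ (subst (+ 2 ∣ₛ_) (i-1+2≡i+1 i) (S.∣m∣n⇒∣m+n 2∣i-1 S.∣-refl))
  where
  i-1+2≡i+1 : ∀ i → i - + 1 + + 2 ≡ i + + 1
  i-1+2≡i+1 = solve-∀
... | suc (suc _) | s≤s (s≤s ()) | _

3∣i⊎3∣i-1⊎3∣i+1 : ∀ i → + 3 ∣ₛ i ⊎ + 3 ∣ₛ i - + 1 ⊎ + 3 ∣ₛ i + + 1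
3∣i⊎3∣i-1⊎3∣i+1 i with i ℤD.% + 3 | ℤD.n%d<d i (+ 3) | n∣i-[i%n] i (+ 3)
... | 0 | _ | 3∣i-0 = inj₁ (subst (+ 3 ∣ₛ_) (ℤP.+-identityʳ i) 3∣i-0)
... | 1 | _ | 3∣i-1 = inj₂ (inj₁ 3∣i-1)
... | 2 | _ | 3∣i-2 = inj₂ (inj₂ (subst (+ 3 ∣ₛ_) (i-2+3≡i+1 i) (S.∣m∣n⇒∣m+n 3∣i-2 S.∣-refl)))
  where
  i-2+3≡i+1 : ∀ i → i - + 2 + + 3 ≡ i + + 1
  i-2+3≡i+1 = solve-∀
... | suc (suc (suc _)) | s≤s (s≤s (s≤s ())) | _

2∤i⇒2∣i+1 : ∀ {i} → ¬ + 2 ∣ₛ i → + 2 ∣ₛ i + + 1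
2∤i⇒2∣i+1 {i} 2∤i with 2∣i⊎2∣i+1 i
... | inj₁ 2∣i   = contradiction 2∣i 2∤i
... | inj₂ 2∣i+1 = 2∣i+1

2∣i+1⇒2∣j+1⇒2∣ij+1 : ∀ i j → + 2 ∣ₛ i + + 1 → + 2 ∣ₛ j + + 1 → + 2 ∣ₛ i * j + + 1
2∣i+1⇒2∣j+1⇒2∣ij+1 i j 2∣i+1 2∣j+1 = subst (+ 2 ∣ₛ_) (sym (ij+1≡ i j))
  (S.∣m∣n⇒∣m+n (S.∣m∣n⇒∣m-n (S.∣m∣n⇒∣m-n (S.∣m⇒∣m*n (j + + 1) 2∣i+1) 2∣i+1) 2∣j+1) S.∣-refl)
  where
  ij+1≡ : ∀ i j → i * j + + 1 ≡ (i + + 1) * (j + + 1) - (i + + 1) - (j + + 1) + + 2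
  ij+1≡ = solve-∀

2∣i-1⇒2∤i : ∀ {i} → + 2 ∣ i - + 1 → ¬ + 2 ∣ i
2∣i-1⇒2∤i {i} 2∣i-1 2∣i = contradiction (ND.∣1⇒≡1 (S.∣⇒∣ᵤ 2∣1)) λ ()
  where
  i-[i-1]≡1 : ∀ i → i - (i - + 1) ≡ + 1
  i-[i-1]≡1 = solve-∀
  2∣1 : + 2 ∣ₛ + 1
  2∣1 = subst (+ 2 ∣ₛ_) (i-[i-1]≡1 i)
    (S.∣m∣n⇒∣m-n (S.∣ᵤ⇒∣ {i = i} 2∣i) (S.∣ᵤ⇒∣ {i = i - + 1} 2∣i-1))

coprime⇒2∤m⊎2∤n : ∀ {m n} → Coprime m n → ¬ 2 ND.∣ m ⊎ ¬ 2 ND.∣ n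
coprime⇒2∤m⊎2∤n {m} m⊥n with 2 ND.∣? m
... | yes 2∣m = inj₂ (λ 2∣n → contradiction (m⊥n (2∣m , 2∣n)) λ ())
... | no 2∤m  = inj₁ 2∤m

∏[rx+1]-1≡x*[e₁+e₂x+e₃x²] : ∀ p q r x →
  (p * x + + 1) * (q * x + + 1) * (r * x + + 1) - + 1
  ≡ x * ((p + q + r) + (p * q + p * r + q * r) * x + p * q * r * x * x)
∏[rx+1]-1≡x*[e₁+e₂x+e₃x²] = solve-∀

-- l is a root of e₁ + e₂ x modulo e₃, hence so is x = e₃ t + l, and the cubic
-- cofactor becomes a multiple of e₃.
x*[e₁+e₂x+e₃x²]≡e₃*x*[k+e₂t+x²] : ∀ e₁ e₂ e₃ l k t → l * e₂ + e₁ ≡ k * e₃ →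
  (e₃ * t + l) * (e₁ + e₂ * (e₃ * t + l) + e₃ * (e₃ * t + l) * (e₃ * t + l))
  ≡ e₃ * (e₃ * t + l) * (k + e₂ * t + (e₃ * t + l) * (e₃ * t + l))
x*[e₁+e₂x+e₃x²]≡e₃*x*[k+e₂t+x²] e₁ e₂ e₃ l k t l*e₂+e₁≡k*e₃ = begin
  x * (e₁ + e₂ * x + e₃ * x * x)                 ≡⟨ regroup e₁ e₂ e₃ l t ⟩
  x * ((l * e₂ + e₁) + e₂ * e₃ * t + e₃ * x * x)
    ≡⟨ cong (λ c → x * (c + e₂ * e₃ * t + e₃ * x * x)) l*e₂+e₁≡k*e₃ ⟩
  x * (k * e₃ + e₂ * e₃ * t + e₃ * x * x)        ≡⟨ pull-out e₂ e₃ l k t ⟩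
  e₃ * x * (k + e₂ * t + x * x)                  ∎
  where
  open ≡-Reasoning
  x : ℤ
  x = e₃ * t + l
  regroup : ∀ e₁ e₂ e₃ l t →
    (e₃ * t + l) * (e₁ + e₂ * (e₃ * t + l) + e₃ * (e₃ * t + l) * (e₃ * t + l))
    ≡ (e₃ * t + l) * ((l * e₂ + e₁) + e₂ * e₃ * t + e₃ * (e₃ * t + l) * (e₃ * t + l))
  regroup = solve-∀
  pull-out : ∀ e₂ e₃ l k t →
    (e₃ * t + l) * (k * e₃ + e₂ * e₃ * t + e₃ * (e₃ * t + l) * (e₃ * t + l))
    ≡ e₃ * (e₃ * t + l) * (k + e₂ * t + (e₃ * t + l) * (e₃ * t + l))
  pull-out = solve-∀

∣∧<2*⇒≡ : ∀ {m n} → m ND.∣ n → 0 < n → n < m ℕ.+ m → n ≡ m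
∣∧<2*⇒≡ {m} (ND.divides 1 refl) _ _ = ℕP.+-identityʳ m
∣∧<2*⇒≡ {m} (ND.divides (suc (suc k)) refl) _ n<2m =
  contradiction n<2m (ℕP.≤⇒≯ (ℕP.+-monoʳ-≤ m (ℕP.m≤m+n m (k ℕ.* m))))

0<m<n≤2⇒m≡1×n≡2 : ∀ {m n} → 0 < m → m < n → n ≤ 2 → m ≡ 1 × n ≡ 2
0<m<n≤2⇒m≡1×n≡2 (s≤s z≤n) (s≤s (s≤s z≤n)) (s≤s (s≤s z≤n)) = refl , refl
0<m<n≤2⇒m≡1×n≡2 {n = suc (suc (suc _))} _ _ (s≤s (s≤s ()))

σ₃∣σ₁⇒r≡123 : ∀ {r₁ r₂ r₃} → Inℛ r₁ r₂ r₃ → σ₃ r₁ r₂ r₃ ND.∣ σ₁ r₁ r₂ r₃ →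
              r₁ ≡ 1 × r₂ ≡ 2 × r₃ ≡ 3
σ₃∣σ₁⇒r≡123 {r₁} {r₂} {r₃} (0<r₁ , r₁<r₂ , r₂<r₃ , _ , _ , r₂⊥r₃) σ₃∣σ₁ =
  r₃≡1+2 (0<m<n≤2⇒m≡1×n≡2 0<r₁ r₁<r₂ (ND.∣⇒≤ r₂∣2))
  where
  r₃∣r₁+r₂ : r₃ ND.∣ r₁ ℕ.+ r₂
  r₃∣r₁+r₂ = ND.∣m+n∣m⇒∣n
    (subst (r₃ ND.∣_) (ℕP.+-comm (r₁ ℕ.+ r₂) r₃) (ND.∣-trans (ND.n∣m*n (r₁ ℕ.* r₂)) σ₃∣σ₁))
    ND.∣-refl
  r₁+r₂≡r₃ : r₁ ℕ.+ r₂ ≡ r₃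
  r₁+r₂≡r₃ = ∣∧<2*⇒≡ r₃∣r₁+r₂ (ℕP.<-≤-trans 0<r₁ (ℕP.m≤m+n r₁ r₂))
                             (ℕP.+-mono-< (ℕP.<-trans r₁<r₂ r₂<r₃) r₂<r₃)
  σ₁≡r₃*2 : σ₁ r₁ r₂ r₃ ≡ r₃ ℕ.* 2
  σ₁≡r₃*2 = begin
    r₁ ℕ.+ r₂ ℕ.+ r₃ ≡⟨ cong (ℕ._+ r₃) r₁+r₂≡r₃ ⟩
    r₃ ℕ.+ r₃        ≡⟨ cong (r₃ ℕ.+_) (ℕP.+-identityʳ r₃) ⟨
    2 ℕ.* r₃         ≡⟨ ℕP.*-comm 2 r₃ ⟩
    r₃ ℕ.* 2         ∎
    where open ≡-Reasoning
  r₂∣2 : r₂ ND.∣ 2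
  r₂∣2 = coprime-divisor r₂⊥r₃
    (subst (r₂ ND.∣_) σ₁≡r₃*2 (ND.∣-trans (ND.∣m⇒∣m*n r₃ (ND.n∣m*n r₁)) σ₃∣σ₁))
  r₃≡1+2 : r₁ ≡ 1 × r₂ ≡ 2 → r₁ ≡ 1 × r₂ ≡ 2 × r₃ ≡ 3
  r₃≡1+2 (refl , refl) = refl , refl , sym r₁+r₂≡r₃

ℓ₁₂₃≡0 : ∀ {ℓ} → Isℓ 1 2 3 ℓ → ℓ ≡ 0
ℓ₁₂₃≡0 {0} _          = refl
ℓ₁₂₃≡0 {1} (_ , 6∣17) = contradiction 6∣17 (from-no (6 ND.∣? 17))
ℓ₁₂₃≡0 {2} (_ , 6∣28) = contradiction 6∣28 (from-no (6 ND.∣? 28))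
ℓ₁₂₃≡0 {3} (_ , 6∣39) = contradiction 6∣39 (from-no (6 ND.∣? 39))
ℓ₁₂₃≡0 {4} (_ , 6∣50) = contradiction 6∣50 (from-no (6 ND.∣? 50))
ℓ₁₂₃≡0 {5} (_ , 6∣61) = contradiction 6∣61 (from-no (6 ND.∣? 61))
ℓ₁₂₃≡0 {suc (suc (suc (suc (suc (suc _)))))} ((s≤s (s≤s (s≤s (s≤s (s≤s (s≤s ())))))) , _)

r≡123⇔ℓ≡0 : ∀ {r₁ r₂ r₃ ℓ} → Inℛ r₁ r₂ r₃ → Isℓ r₁ r₂ r₃ ℓ →
            (r₁ ≡ 1 × r₂ ≡ 2 × r₃ ≡ 3) ⇔ ℓ ≡ 0
r≡123⇔ℓ≡0 {r₁} {r₂} {r₃} {ℓ} r∈ℛ ℓ-def = mk⇔ r≡123⇒ℓ≡0 ℓ≡0⇒r≡123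
  where
  r≡123⇒ℓ≡0 : r₁ ≡ 1 × r₂ ≡ 2 × r₃ ≡ 3 → ℓ ≡ 0
  r≡123⇒ℓ≡0 (refl , refl , refl) = ℓ₁₂₃≡0 ℓ-def
  ℓ≡0⇒r≡123 : ℓ ≡ 0 → r₁ ≡ 1 × r₂ ≡ 2 × r₃ ≡ 3
  ℓ≡0⇒r≡123 refl = σ₃∣σ₁⇒r≡123 r∈ℛ (proj₂ ℓ-def)

b≡1⇒ℓ≡0 : ∀ {r ℓ} → 0 < r → b ℓ r ≡ + 1 → ℓ ≡ 0
b≡1⇒ℓ≡0 {r} 0<r b≡1 with ℕP.m*n≡0⇒m≡0∨n≡0 r (ℕP.+-cancelʳ-≡ 1 _ 0 (ℤP.+-injective b≡1))
... | inj₁ refl = contradiction 0<r λ ()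
... | inj₂ ℓ≡0  = ℓ≡0

ℓ≡0⇒b≡1 : ∀ r {ℓ} → ℓ ≡ 0 → b ℓ r ≡ + 1
ℓ≡0⇒b≡1 r refl = cong (λ n → + (n ℕ.+ 1)) (ℕP.*-zeroʳ r)

b≡1⇔ℓ≡0 : ∀ {r₁ r₂ r₃ ℓ} → 0 < r₁ →
          (b ℓ r₁ ≡ + 1 × b ℓ r₂ ≡ + 1 × b ℓ r₃ ≡ + 1) ⇔ ℓ ≡ 0
b≡1⇔ℓ≡0 {r₁} {r₂} {r₃} 0<r₁ = mk⇔
  (λ (b₁≡1 , _) → b≡1⇒ℓ≡0 0<r₁ b₁≡1)
  (λ ℓ≡0 → ℓ≡0⇒b≡1 r₁ ℓ≡0 , ℓ≡0⇒b≡1 r₂ ℓ≡0 , ℓ≡0⇒b≡1 r₃ ℓ≡0)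

δ-spec : ∀ ℓ t → (+ 2 ∣ t - + ℓ × δ ℓ t ≡ 1) ⊎ (¬ + 2 ∣ t - + ℓ × δ ℓ t ≡ 0)
δ-spec ℓ t = if-spec (2 ND.∣? ℤ.∣ t - + ℓ ∣)
  where
  if-spec : ∀ {P : Set} (P? : Dec P) →
            (P × (if ⌊ P? ⌋ then 1 else 0) ≡ 1) ⊎ (¬ P × (if ⌊ P? ⌋ then 1 else 0) ≡ 0)
  if-spec (yes p) = inj₁ (p , refl)
  if-spec (no ¬p) = inj₂ (¬p , refl)

module _ (r₁ r₂ r₃ ℓ : ℕ) where

  U[0]≡b*b*b : U r₁ r₂ r₃ ℓ (+ 0) ≡ b ℓ r₁ * b ℓ r₂ * b ℓ r₃
  U[0]≡b*b*b = cong₂ _*_ (cong₂ _*_ (a*0+b≡b r₁) (a*0+b≡b r₂)) (a*0+b≡b r₃)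
    where
    a*0+b≡b : ∀ r → a r₁ r₂ r₃ r * + 0 + b ℓ r ≡ b ℓ r
    a*0+b≡b r = cong (_+ b ℓ r) (ℤP.*-zeroʳ (a r₁ r₂ r₃ r))

  U[0]≡1⇔ℓ≡0 : 0 < r₁ → U r₁ r₂ r₃ ℓ (+ 0) ≡ + 1 ⇔ ℓ ≡ 0
  U[0]≡1⇔ℓ≡0 0<r₁ = mk⇔ U[0]≡1⇒ℓ≡0 ℓ≡0⇒U[0]≡1
    where
    U[0]≡1⇒ℓ≡0 : U r₁ r₂ r₃ ℓ (+ 0) ≡ + 1 → ℓ ≡ 0
    U[0]≡1⇒ℓ≡0 U[0]≡1 =
      b≡1⇒ℓ≡0 0<r₁ (cong +_ (ℕP.m*n≡1⇒m≡1 _ _ (ℕP.m*n≡1⇒m≡1 _ _ (ℤP.+-injective (begin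
        + ((r₁ ℕ.* ℓ ℕ.+ 1) ℕ.* (r₂ ℕ.* ℓ ℕ.+ 1) ℕ.* (r₃ ℕ.* ℓ ℕ.+ 1))
          ≡⟨ ℤP.pos-* ((r₁ ℕ.* ℓ ℕ.+ 1) ℕ.* (r₂ ℕ.* ℓ ℕ.+ 1)) (r₃ ℕ.* ℓ ℕ.+ 1) ⟩
        + ((r₁ ℕ.* ℓ ℕ.+ 1) ℕ.* (r₂ ℕ.* ℓ ℕ.+ 1)) * b ℓ r₃
          ≡⟨ cong (_* b ℓ r₃) (ℤP.pos-* (r₁ ℕ.* ℓ ℕ.+ 1) (r₂ ℕ.* ℓ ℕ.+ 1)) ⟩
        b ℓ r₁ * b ℓ r₂ * b ℓ r₃
          ≡⟨ U[0]≡b*b*b ⟨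
        U r₁ r₂ r₃ ℓ (+ 0)
          ≡⟨ U[0]≡1 ⟩
        + 1 ∎)))))
      where open ≡-Reasoning
    ℓ≡0⇒U[0]≡1 : ℓ ≡ 0 → U r₁ r₂ r₃ ℓ (+ 0) ≡ + 1
    ℓ≡0⇒U[0]≡1 ℓ≡0 = trans U[0]≡b*b*b
      (cong₂ _*_ (cong₂ _*_ (ℓ≡0⇒b≡1 r₁ ℓ≡0) (ℓ≡0⇒b≡1 r₂ ℓ≡0)) (ℓ≡0⇒b≡1 r₃ ℓ≡0))

  X : ℤ → ℤ
  X t = + σ₃ r₁ r₂ r₃ * t + + ℓ

  X[0]≡ℓ : X (+ 0) ≡ + ℓ
  X[0]≡ℓ = cong (_+ + ℓ) (ℤP.*-zeroʳ (+ σ₃ r₁ r₂ r₃))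

  X[1]≡σ₃+ℓ : X (+ 1) ≡ + σ₃ r₁ r₂ r₃ + + ℓ
  X[1]≡σ₃+ℓ = cong (_+ + ℓ) (ℤP.*-identityʳ (+ σ₃ r₁ r₂ r₃))

  g∣X : ∀ t → + gcd (σ₃ r₁ r₂ r₃) ℓ ∣ₛ X t
  g∣X t = S.∣m∣n⇒∣m+n (S.∣m⇒∣m*n t (∣⇒+∣+ (gcd[m,n]∣m (σ₃ r₁ r₂ r₃) ℓ)))
                      (∣⇒+∣+ (gcd[m,n]∣n (σ₃ r₁ r₂ r₃) ℓ))

  U≡∏[r*X+1] : ∀ t →
    U r₁ r₂ r₃ ℓ t ≡ (+ r₁ * X t + + 1) * (+ r₂ * X t + + 1) * (+ r₃ * X t + + 1)
  U≡∏[r*X+1] t = cong₂ _*_ (cong₂ _*_ (a*t+b≡r*X+1 r₁) (a*t+b≡r*X+1 r₂)) (a*t+b≡r*X+1 r₃)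
    where
    distrib : ∀ r s t l → r * s * t + (r * l + + 1) ≡ r * (s * t + l) + + 1
    distrib = solve-∀
    a*t+b≡r*X+1 : ∀ r → a r₁ r₂ r₃ r * t + b ℓ r ≡ + r * X t + + 1
    a*t+b≡r*X+1 r = trans
      (cong₂ (λ u v → u * t + v) (ℤP.pos-* r (σ₃ r₁ r₂ r₃))
                                 (trans (ℤP.pos-+ (r ℕ.* ℓ) 1) (cong (_+ + 1) (ℤP.pos-* r ℓ))))
      (distrib (+ r) (+ σ₃ r₁ r₂ r₃) t (+ ℓ))

  U-1≡σ₃*X*[k+σ₂t+X²] : ∀ {k} → ℓ ℕ.* σ₂ r₁ r₂ r₃ ℕ.+ σ₁ r₁ r₂ r₃ ≡ k ℕ.* σ₃ r₁ r₂ r₃ → ∀ t →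
    U r₁ r₂ r₃ ℓ t - + 1 ≡ + σ₃ r₁ r₂ r₃ * X t * (+ k + + σ₂ r₁ r₂ r₃ * t + X t * X t)
  U-1≡σ₃*X*[k+σ₂t+X²] {k} ℓσ₂+σ₁≡kσ₃ t = begin
    U r₁ r₂ r₃ ℓ t - + 1
      ≡⟨ cong (_- + 1) (U≡∏[r*X+1] t) ⟩
    (+ r₁ * X t + + 1) * (+ r₂ * X t + + 1) * (+ r₃ * X t + + 1) - + 1
      ≡⟨ ∏[rx+1]-1≡x*[e₁+e₂x+e₃x²] (+ r₁) (+ r₂) (+ r₃) (X t) ⟩
    X t * ((+ r₁ + + r₂ + + r₃) + (+ r₁ * + r₂ + + r₁ * + r₃ + + r₂ * + r₃) * X t
           + + r₁ * + r₂ * + r₃ * X t * X t)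
      ≡⟨ cong₂ (λ e₁+e₂X e₃ → X t * (e₁+e₂X + e₃ * X t * X t)) +σ₁+σ₂X +σ₃ ⟨
    X t * (+ σ₁ r₁ r₂ r₃ + + σ₂ r₁ r₂ r₃ * X t + + σ₃ r₁ r₂ r₃ * X t * X t)
      ≡⟨ x*[e₁+e₂x+e₃x²]≡e₃*x*[k+e₂t+x²] _ _ _ (+ ℓ) (+ k) t +ℓσ₂+σ₁≡kσ₃ ⟩
    + σ₃ r₁ r₂ r₃ * X t * (+ k + + σ₂ r₁ r₂ r₃ * t + X t * X t) ∎
    where
    open ≡-Reasoning
    +σ₁+σ₂X : + σ₁ r₁ r₂ r₃ + + σ₂ r₁ r₂ r₃ * X t
              ≡ (+ r₁ + + r₂ + + r₃) + (+ r₁ * + r₂ + + r₁ * + r₃ + + r₂ * + r₃) * X t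
    +σ₁+σ₂X = cong₂ (λ e₁ e₂ → e₁ + e₂ * X t)
      (trans (ℤP.pos-+ (r₁ ℕ.+ r₂) r₃) (cong (_+ + r₃) (ℤP.pos-+ r₁ r₂)))
      (trans (ℤP.pos-+ (r₁ ℕ.* r₂ ℕ.+ r₁ ℕ.* r₃) (r₂ ℕ.* r₃))
        (cong₂ _+_ (trans (ℤP.pos-+ (r₁ ℕ.* r₂) (r₁ ℕ.* r₃))
                          (cong₂ _+_ (ℤP.pos-* r₁ r₂) (ℤP.pos-* r₁ r₃)))
                   (ℤP.pos-* r₂ r₃)))
    +σ₃ : + σ₃ r₁ r₂ r₃ ≡ + r₁ * + r₂ * + r₃
    +σ₃ = trans (ℤP.pos-* (r₁ ℕ.* r₂) r₃) (cong (_* + r₃) (ℤP.pos-* r₁ r₂))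
    +ℓσ₂+σ₁≡kσ₃ : + ℓ * + σ₂ r₁ r₂ r₃ + + σ₁ r₁ r₂ r₃ ≡ + k * + σ₃ r₁ r₂ r₃
    +ℓσ₂+σ₁≡kσ₃ = begin
      + ℓ * + σ₂ r₁ r₂ r₃ + + σ₁ r₁ r₂ r₃   ≡⟨ cong (_+ + σ₁ r₁ r₂ r₃) (ℤP.pos-* ℓ (σ₂ r₁ r₂ r₃)) ⟨
      + (ℓ ℕ.* σ₂ r₁ r₂ r₃) + + σ₁ r₁ r₂ r₃ ≡⟨ ℤP.pos-+ (ℓ ℕ.* σ₂ r₁ r₂ r₃) (σ₁ r₁ r₂ r₃) ⟨
      + (ℓ ℕ.* σ₂ r₁ r₂ r₃ ℕ.+ σ₁ r₁ r₂ r₃) ≡⟨ cong +_ ℓσ₂+σ₁≡kσ₃ ⟩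
      + (k ℕ.* σ₃ r₁ r₂ r₃)                 ≡⟨ ℤP.pos-* k (σ₃ r₁ r₂ r₃) ⟩
      + k * + σ₃ r₁ r₂ r₃                   ∎

  some-r-odd∧X-odd⇒2∣U : ¬ 2 ND.∣ r₁ ⊎ ¬ 2 ND.∣ r₂ → ∀ t → + 2 ∣ₛ X t + + 1 →
                         + 2 ∣ₛ U r₁ r₂ r₃ ℓ t
  some-r-odd∧X-odd⇒2∣U r-odd t X-odd = subst (+ 2 ∣ₛ_) (sym (U≡∏[r*X+1] t))
    (S.∣m⇒∣m*n (+ r₃ * X t + + 1) (2∣factor r-odd))
    where
    2∣r*X+1 : ∀ {r} → ¬ 2 ND.∣ r → + 2 ∣ₛ + r * X t + + 1
    2∣r*X+1 {r} 2∤r = 2∣i+1⇒2∣j+1⇒2∣ij+1 (+ r) (X t) (2∤i⇒2∣i+1 (∤⇒+∤+ 2∤r)) X-odd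
    2∣factor : ¬ 2 ND.∣ r₁ ⊎ ¬ 2 ND.∣ r₂ → + 2 ∣ₛ (+ r₁ * X t + + 1) * (+ r₂ * X t + + 1)
    2∣factor (inj₁ 2∤r₁) = S.∣m⇒∣m*n (+ r₂ * X t + + 1) (2∣r*X+1 2∤r₁)
    2∣factor (inj₂ 2∤r₂) = S.∣n⇒∣m*n (+ r₁ * X t + + 1) (2∣r*X+1 2∤r₂)

  X≡σ₃[t-ℓ]+ℓ[σ₃+1] : ∀ t → X t ≡ + σ₃ r₁ r₂ r₃ * (t - + ℓ) + + ℓ * (+ σ₃ r₁ r₂ r₃ + + 1)
  X≡σ₃[t-ℓ]+ℓ[σ₃+1] t = split (+ σ₃ r₁ r₂ r₃) t (+ ℓ)
    where
    split : ∀ σ t l → σ * t + l ≡ σ * (t - l) + l * (σ + + 1)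
    split = solve-∀

  2∤σ₃∧2∣t-ℓ⇒2g∣X : ¬ 2 ND.∣ σ₃ r₁ r₂ r₃ → ∀ t → + 2 ∣ₛ t - + ℓ →
                    + gcd (σ₃ r₁ r₂ r₃) ℓ * + 2 ∣ₛ X t
  2∤σ₃∧2∣t-ℓ⇒2g∣X 2∤σ₃ t 2∣t-ℓ = subst (_ ∣ₛ_) (sym (X≡σ₃[t-ℓ]+ℓ[σ₃+1] t))
    (S.∣m∣n⇒∣m+n (*-pres-∣ₛ (∣⇒+∣+ (gcd[m,n]∣m (σ₃ r₁ r₂ r₃) ℓ)) 2∣t-ℓ)
                 (*-pres-∣ₛ (∣⇒+∣+ (gcd[m,n]∣n (σ₃ r₁ r₂ r₃) ℓ)) (2∤i⇒2∣i+1 (∤⇒+∤+ 2∤σ₃))))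

  2∤σ₃∧2∤t-ℓ⇒2∣U : ¬ 2 ND.∣ σ₃ r₁ r₂ r₃ → ∀ t → ¬ + 2 ∣ₛ t - + ℓ → + 2 ∣ₛ U r₁ r₂ r₃ ℓ t
  2∤σ₃∧2∤t-ℓ⇒2∣U 2∤σ₃ t 2∤t-ℓ = some-r-odd∧X-odd⇒2∣U (inj₁ 2∤r₁) t 2∣X+1
    where
    2∤r₁ : ¬ 2 ND.∣ r₁
    2∤r₁ 2∣r₁ = 2∤σ₃ (ND.∣-trans 2∣r₁ (ND.∣m⇒∣m*n r₃ (ND.m∣m*n r₂)))
    2∣σ₃+1 : + 2 ∣ₛ + σ₃ r₁ r₂ r₃ + + 1
    2∣σ₃+1 = 2∤i⇒2∣i+1 (∤⇒+∤+ 2∤σ₃)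
    split : ∀ σ t l → σ * t + l + + 1 ≡ (σ * (t - l) + + 1) + l * (σ + + 1)
    split = solve-∀
    2∣X+1 : + 2 ∣ₛ X t + + 1
    2∣X+1 = subst (+ 2 ∣ₛ_) (sym (split (+ σ₃ r₁ r₂ r₃) t (+ ℓ)))
      (S.∣m∣n⇒∣m+n (2∣i+1⇒2∣j+1⇒2∣ij+1 (+ σ₃ r₁ r₂ r₃) (t - + ℓ) 2∣σ₃+1 (2∤i⇒2∣i+1 2∤t-ℓ))
                   (S.∣n⇒∣m*n (+ ℓ) 2∣σ₃+1))

  module _ (ℓ-def : Isℓ r₁ r₂ r₃ ℓ) where

    σ₃d∣U-1 : ∀ {d} t → d ∣ₛ X t → + σ₃ r₁ r₂ r₃ * d ∣ₛ U r₁ r₂ r₃ ℓ t - + 1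
    σ₃d∣U-1 t d∣X with proj₂ ℓ-def
    ... | ND.divides k ℓσ₂+σ₁≡kσ₃ = subst (_ ∣ₛ_) (sym (U-1≡σ₃*X*[k+σ₂t+X²] {k} ℓσ₂+σ₁≡kσ₃ t))
      (S.∣m⇒∣m*n _ (S.*-monoʳ-∣ (+ σ₃ r₁ r₂ r₃) d∣X))

    σ₃ℓ∣U[0]-1 : + σ₃ r₁ r₂ r₃ * + ℓ ∣ U r₁ r₂ r₃ ℓ (+ 0) - + 1
    σ₃ℓ∣U[0]-1 = S.∣⇒∣ᵤ (σ₃d∣U-1 (+ 0) (S.∣-reflexive (sym X[0]≡ℓ)))

    σ₃[σ₃+ℓ]∣U[1]-1 : + σ₃ r₁ r₂ r₃ * (+ σ₃ r₁ r₂ r₃ + + ℓ) ∣ U r₁ r₂ r₃ ℓ (+ 1) - + 1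
    σ₃[σ₃+ℓ]∣U[1]-1 = S.∣⇒∣ᵤ (σ₃d∣U-1 (+ 1) (S.∣-reflexive (sym X[1]≡σ₃+ℓ)))

    σ₃g∣U-1 : ∀ t → + σ₃ r₁ r₂ r₃ * + gcd (σ₃ r₁ r₂ r₃) ℓ ∣ₛ U r₁ r₂ r₃ ℓ t - + 1
    σ₃g∣U-1 t = σ₃d∣U-1 t (g∣X t)

    -- If ℓ were odd, U(0) would be even (the factor r ℓ + 1 of an odd r) and
    -- odd (σ₃ ℓ ∣ U(0) − 1) at once.
    2∣σ₃⇒2∣ℓ : Coprime r₁ r₂ → 2 ND.∣ σ₃ r₁ r₂ r₃ → 2 ND.∣ ℓ
    2∣σ₃⇒2∣ℓ r₁⊥r₂ 2∣σ₃ with 2 ND.∣? ℓ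
    ... | yes 2∣ℓ = 2∣ℓ
    ... | no 2∤ℓ  = contradiction (S.∣⇒∣ᵤ 2∣U[0]) (2∣i-1⇒2∤i {U r₁ r₂ r₃ ℓ (+ 0)} (S.∣⇒∣ᵤ 2∣U[0]-1))
      where
      2∣U[0]-1 : + 2 ∣ₛ U r₁ r₂ r₃ ℓ (+ 0) - + 1
      2∣U[0]-1 = S.∣-trans (S.∣m⇒∣m*n (X (+ 0)) (∣⇒+∣+ 2∣σ₃)) (σ₃d∣U-1 (+ 0) S.∣-refl)
      2∣U[0] : + 2 ∣ₛ U r₁ r₂ r₃ ℓ (+ 0)
      2∣U[0] = some-r-odd∧X-odd⇒2∣U (coprime⇒2∤m⊎2∤n r₁⊥r₂) (+ 0)
        (subst (λ x → + 2 ∣ₛ x + + 1) (sym X[0]≡ℓ) (2∤i⇒2∣i+1 (∤⇒+∤+ 2∤ℓ)))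

    2∣σ₃⇒U-odd : Coprime r₁ r₂ → 2 ND.∣ σ₃ r₁ r₂ r₃ → ∀ t →
                 ¬ + 2 ∣ U r₁ r₂ r₃ ℓ t × + 4 ∣ U r₁ r₂ r₃ ℓ t - + 1
    2∣σ₃⇒U-odd r₁⊥r₂ 2∣σ₃ t =
      2∣i-1⇒2∤i {U r₁ r₂ r₃ ℓ t} (ND.∣-trans (ND.divides 2 refl) 4∣U-1) , 4∣U-1
      where
      2∣g : 2 ND.∣ gcd (σ₃ r₁ r₂ r₃) ℓ
      2∣g = gcd-greatest 2∣σ₃ (2∣σ₃⇒2∣ℓ r₁⊥r₂ 2∣σ₃)
      4∣U-1 : + 4 ∣ U r₁ r₂ r₃ ℓ t - + 1
      4∣U-1 = S.∣⇒∣ᵤ (S.∣-trans (*-pres-∣ₛ (∣⇒+∣+ 2∣σ₃) (∣⇒+∣+ 2∣g)) (σ₃g∣U-1 t))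

    2∤σ₃∧2∣t-ℓ⇒2σ₃g∣U-1 : ¬ 2 ND.∣ σ₃ r₁ r₂ r₃ → ∀ t → + 2 ∣ₛ t - + ℓ →
      + 2 * + σ₃ r₁ r₂ r₃ * + gcd (σ₃ r₁ r₂ r₃) ℓ ∣ₛ U r₁ r₂ r₃ ℓ t - + 1
    2∤σ₃∧2∣t-ℓ⇒2σ₃g∣U-1 2∤σ₃ t 2∣t-ℓ =
      subst (_∣ₛ U r₁ r₂ r₃ ℓ t - + 1) (reassoc (+ σ₃ r₁ r₂ r₃) (+ gcd (σ₃ r₁ r₂ r₃) ℓ))
        (σ₃d∣U-1 t (2∤σ₃∧2∣t-ℓ⇒2g∣X 2∤σ₃ t 2∣t-ℓ))
      where
      reassoc : ∀ σ g → σ * (g * + 2) ≡ + 2 * σ * g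
      reassoc = solve-∀

    2∤σ₃⇒U≡δ : ¬ 2 ND.∣ σ₃ r₁ r₂ r₃ → ∀ t →
               + 2 ∣ U r₁ r₂ r₃ ℓ t - + δ ℓ t
               × + (2 ℕ.^ δ ℓ t) * + σ₃ r₁ r₂ r₃ * + gcd (σ₃ r₁ r₂ r₃) ℓ ∣ U r₁ r₂ r₃ ℓ t - + 1
    2∤σ₃⇒U≡δ 2∤σ₃ t with δ-spec ℓ t
    ... | inj₁ (2∣t-ℓ , δ≡1) rewrite δ≡1 =
        S.∣⇒∣ᵤ (S.∣-trans (S.∣m⇒∣m*n _ (S.∣m⇒∣m*n (+ σ₃ r₁ r₂ r₃) (S.∣-refl {+ 2}))) 2σ₃g∣U-1)
      , S.∣⇒∣ᵤ 2σ₃g∣U-1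
      where
      2σ₃g∣U-1 : + 2 * + σ₃ r₁ r₂ r₃ * + gcd (σ₃ r₁ r₂ r₃) ℓ ∣ₛ U r₁ r₂ r₃ ℓ t - + 1
      2σ₃g∣U-1 = 2∤σ₃∧2∣t-ℓ⇒2σ₃g∣U-1 2∤σ₃ t (S.∣ᵤ⇒∣ {i = t - + ℓ} 2∣t-ℓ)
    ... | inj₂ (2∤t-ℓ , δ≡0) rewrite δ≡0 =
        S.∣⇒∣ᵤ (subst (+ 2 ∣ₛ_) (sym (ℤP.+-identityʳ (U r₁ r₂ r₃ ℓ t)))
                      (2∤σ₃∧2∤t-ℓ⇒2∣U 2∤σ₃ t (2∤t-ℓ ∘ S.∣⇒∣ᵤ {i = t - + ℓ})))
      , S.∣⇒∣ᵤ (subst (_∣ₛ U r₁ r₂ r₃ ℓ t - + 1)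
                      (cong (_* + gcd (σ₃ r₁ r₂ r₃) ℓ) (sym (ℤP.*-identityˡ (+ σ₃ r₁ r₂ r₃))))
                      (σ₃g∣U-1 t))

V₁₂₃ : ℤ → ℤ
V₁₂₃ t = t * (+ 1 + + 11 * t + + 36 * (t * t))

U₁₂₃-1≡36*V₁₂₃ : ∀ t → U 1 2 3 0 t - + 1 ≡ + 36 * V₁₂₃ t
U₁₂₃-1≡36*V₁₂₃ = expand
  where
  expand : ∀ t → (+ 6 * t + + 1) * (+ 12 * t + + 1) * (+ 18 * t + + 1) - + 1
                 ≡ + 36 * (t * (+ 1 + + 11 * t + + 36 * (t * t)))
  expand = solve-∀

2∣V₁₂₃ : ∀ t → + 2 ∣ₛ V₁₂₃ t
2∣V₁₂₃ t = subst (+ 2 ∣ₛ_) (sym (V≡ t))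
  (S.∣m∣n⇒∣m+n 2∣t[t+1] (S.∣m⇒∣m*n (+ 5 * (t * t) + + 18 * (t * t * t)) S.∣-refl))
  where
  V≡ : ∀ t → t * (+ 1 + + 11 * t + + 36 * (t * t))
             ≡ t * (t + + 1) + + 2 * (+ 5 * (t * t) + + 18 * (t * t * t))
  V≡ = solve-∀
  2∣t[t+1] : + 2 ∣ₛ t * (t + + 1)
  2∣t[t+1] with 2∣i⊎2∣i+1 t
  ... | inj₁ 2∣t   = S.∣m⇒∣m*n (t + + 1) 2∣t
  ... | inj₂ 2∣t+1 = S.∣n⇒∣m*n t 2∣t+1

3∣V₁₂₃ : ∀ t → ¬ + 3 ∣ₛ t + + 1 → + 3 ∣ₛ V₁₂₃ t
3∣V₁₂₃ t 3∤t+1 = subst (+ 3 ∣ₛ_) (sym (V≡ t))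
  (S.∣m∣n⇒∣m-n (S.∣m⇒∣m*n (+ 4 * (t * t) + + 12 * (t * t * t)) S.∣-refl) 3∣t[t-1])
  where
  V≡ : ∀ t → t * (+ 1 + + 11 * t + + 36 * (t * t))
             ≡ + 3 * (+ 4 * (t * t) + + 12 * (t * t * t)) - t * (t - + 1)
  V≡ = solve-∀
  3∣t[t-1] : + 3 ∣ₛ t * (t - + 1)
  3∣t[t-1] with 3∣i⊎3∣i-1⊎3∣i+1 t
  ... | inj₁ 3∣t          = S.∣m⇒∣m*n (t - + 1) 3∣t
  ... | inj₂ (inj₁ 3∣t-1) = S.∣n⇒∣m*n t 3∣t-1
  ... | inj₂ (inj₂ 3∣t+1) = contradiction 3∣t+1 3∤t+1

U₁₂₃-congruences : ∀ {ℓ} → ℓ ≡ 0 →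
    (∀ t → + 72 ∣ U 1 2 3 ℓ t - + 1)
  × (∀ t → ¬ + 3 ∣ t + + 1 → + 216 ∣ U 1 2 3 ℓ t - + 1)
  × (∀ t → ¬ + 2 ∣ U 1 2 3 ℓ t)
  × (∀ t → + 8 ∣ U 1 2 3 ℓ t - + 1)
U₁₂₃-congruences refl = 72∣U-1 , 216∣U-1 , 2∤U , 8∣U-1
  where
  36d∣U-1 : ∀ {d} t → d ∣ₛ V₁₂₃ t → + 36 * d ∣ U 1 2 3 0 t - + 1
  36d∣U-1 t d∣V = S.∣⇒∣ᵤ (subst (_ ∣ₛ_) (sym (U₁₂₃-1≡36*V₁₂₃ t)) (S.*-monoʳ-∣ (+ 36) d∣V))
  72∣U-1 : ∀ t → + 72 ∣ U 1 2 3 0 t - + 1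
  72∣U-1 t = 36d∣U-1 t (2∣V₁₂₃ t)
  216∣U-1 : ∀ t → ¬ + 3 ∣ t + + 1 → + 216 ∣ U 1 2 3 0 t - + 1
  -- lcm 2 3 computes to 6
  216∣U-1 t 3∤t+1 = 36d∣U-1 {+ 6} t (S.∣ᵤ⇒∣ {i = V₁₂₃ t} (lcm-least (S.∣⇒∣ᵤ (2∣V₁₂₃ t))
                                                (S.∣⇒∣ᵤ (3∣V₁₂₃ t (3∤t+1 ∘ S.∣⇒∣ᵤ {i = t + + 1})))))
  8∣U-1 : ∀ t → + 8 ∣ U 1 2 3 0 t - + 1
  8∣U-1 t = ND.∣-trans (ND.divides 9 refl) (72∣U-1 t)
  2∤U : ∀ t → ¬ + 2 ∣ U 1 2 3 0 t
  2∤U t = 2∣i-1⇒2∤i {U 1 2 3 0 t} (ND.∣-trans (ND.divides 4 refl) (8∣U-1 t))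

theorem4p3 : (r₁ r₂ r₃ ℓ : ℕ) → Inℛ r₁ r₂ r₃ → Isℓ r₁ r₂ r₃ ℓ →
    -- (i)
    ( ((r₁ ≡ 1 × r₂ ≡ 2 × r₃ ≡ 3) →
        (U r₁ r₂ r₃ ℓ (+ 0) ≡ + 1) × (ℓ ≡ 0)
        × (b ℓ r₁ ≡ + 1) × (b ℓ r₂ ≡ + 1) × (b ℓ r₃ ≡ + 1)
        × (∀ (t : ℤ) → (+ 2 * + σ₃ r₁ r₂ r₃ * + σ₃ r₁ r₂ r₃) ∣ (U r₁ r₂ r₃ ℓ t - + 1))
        × (∀ (t : ℤ) → ¬ (+ 3 ∣ (t + + 1))
             → (+ σ₃ r₁ r₂ r₃ * + σ₃ r₁ r₂ r₃ * + σ₃ r₁ r₂ r₃) ∣ (U r₁ r₂ r₃ ℓ t - + 1))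
        × (∀ (t : ℤ) → ¬ (+ 2 ∣ U r₁ r₂ r₃ ℓ t))
        × (∀ (t : ℤ) → + 8 ∣ (U r₁ r₂ r₃ ℓ t - + 1)))
    -- the properties in (i) are equivalent
    × ((r₁ ≡ 1 × r₂ ≡ 2 × r₃ ≡ 3) ⇔ (U r₁ r₂ r₃ ℓ (+ 0) ≡ + 1))
    × ((r₁ ≡ 1 × r₂ ≡ 2 × r₃ ≡ 3) ⇔ (ℓ ≡ 0))
    × ((r₁ ≡ 1 × r₂ ≡ 2 × r₃ ≡ 3) ⇔ ((b ℓ r₁ ≡ + 1) × (b ℓ r₂ ≡ + 1) × (b ℓ r₃ ≡ + 1))) )
    ×
    -- (ii)
    ( ¬ (r₁ ≡ 1 × r₂ ≡ 2 × r₃ ≡ 3) →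
        (ℓ ≢ 0)
        × (b ℓ r₁ ≢ + 1) × (b ℓ r₂ ≢ + 1) × (b ℓ r₃ ≢ + 1)
        × ((+ σ₃ r₁ r₂ r₃ * + ℓ) ∣ (U r₁ r₂ r₃ ℓ (+ 0) - + 1))
        × ((+ σ₃ r₁ r₂ r₃ * (+ σ₃ r₁ r₂ r₃ + + ℓ)) ∣ (U r₁ r₂ r₃ ℓ (+ 1) - + 1))
        × (∀ (t : ℤ) → (+ σ₃ r₁ r₂ r₃ * + gcd (σ₃ r₁ r₂ r₃) ℓ) ∣ (U r₁ r₂ r₃ ℓ t - + 1))
        × (2 ND.∣ σ₃ r₁ r₂ r₃ → ∀ (t : ℤ) →
             ¬ (+ 2 ∣ U r₁ r₂ r₃ ℓ t) × (+ 4 ∣ (U r₁ r₂ r₃ ℓ t - + 1)))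
        × (¬ (2 ND.∣ σ₃ r₁ r₂ r₃) → ∀ (t : ℤ) →
             (+ 2 ∣ (U r₁ r₂ r₃ ℓ t - + δ ℓ t))
             × ((+ (2 ℕ.^ δ ℓ t) * + σ₃ r₁ r₂ r₃ * + gcd (σ₃ r₁ r₂ r₃) ℓ)
                  ∣ (U r₁ r₂ r₃ ℓ t - + 1))) )
theorem4p3 r₁ r₂ r₃ ℓ r∈ℛ@(0<r₁ , r₁<r₂ , r₂<r₃ , r₁⊥r₂ , _) ℓ-def =
    ( (λ { r≡123@(refl , refl , refl) →
             let ℓ≡0 = to r≡123⇔ℓ≡0′ r≡123 in
             from (U[0]≡1⇔ℓ≡0 r₁ r₂ r₃ ℓ 0<r₁) ℓ≡0 , ℓ≡0
           , ℓ≡0⇒b≡1 1 ℓ≡0 , ℓ≡0⇒b≡1 2 ℓ≡0 , ℓ≡0⇒b≡1 3 ℓ≡0 , U₁₂₃-congruences ℓ≡0 })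
    , ⇔-trans r≡123⇔ℓ≡0′ (⇔-sym (U[0]≡1⇔ℓ≡0 r₁ r₂ r₃ ℓ 0<r₁))
    , r≡123⇔ℓ≡0′
    , ⇔-trans r≡123⇔ℓ≡0′ (⇔-sym (b≡1⇔ℓ≡0 {r₂ = r₂} {r₃} 0<r₁)) )
  , λ r≢123 → let ℓ≢0 = r≢123 ∘ from r≡123⇔ℓ≡0′ in
      ℓ≢0 , ℓ≢0 ∘ b≡1⇒ℓ≡0 0<r₁ , ℓ≢0 ∘ b≡1⇒ℓ≡0 0<r₂ , ℓ≢0 ∘ b≡1⇒ℓ≡0 (ℕP.<-trans 0<r₂ r₂<r₃)
    , σ₃ℓ∣U[0]-1 r₁ r₂ r₃ ℓ ℓ-def , σ₃[σ₃+ℓ]∣U[1]-1 r₁ r₂ r₃ ℓ ℓ-def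
    , S.∣⇒∣ᵤ ∘ σ₃g∣U-1 r₁ r₂ r₃ ℓ ℓ-def
    , 2∣σ₃⇒U-odd r₁ r₂ r₃ ℓ ℓ-def r₁⊥r₂ , 2∤σ₃⇒U≡δ r₁ r₂ r₃ ℓ ℓ-def
  where
  r≡123⇔ℓ≡0′ : (r₁ ≡ 1 × r₂ ≡ 2 × r₃ ≡ 3) ⇔ ℓ ≡ 0
  r≡123⇔ℓ≡0′ = r≡123⇔ℓ≡0 r∈ℛ ℓ-def
  0<r₂ : 0 < r₂
  0<r₂ = ℕP.<-trans 0<r₁ r₁<r₂
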